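{- Let $X\subseteq\mathrm{PVAR}$ be finite, $\alpha\geq 1$, and $\varphi\in\mathrm{CoreType}(X,\alpha)$. Then $\neg\varphi$ is valid if and only if $\vdash_{\mathsf{C}}\neg\varphi$.
   Context: Let $\mathrm{PVAR}$ be a countably infinite set of program variables and $\mathrm{LOC}$ a countably infinite set of locations. A memory state is a pair $(s,h)$ with $s:\mathrm{PVAR}\to\mathrm{LOC}$ and $h:\mathrm{LOC}\to\mathrm{LOC}$ a partial function with finite domain $\mathrm{dom}(h)$. Formulae of separation logic $\mathrm{SL}(*,-\!*)$: $\varphi ::= x=y \mid x\hookrightarrow y \mid \mathrm{emp} \mid \neg\varphi \mid \varphi\wedge\varphi \mid \varphi*\varphi \mid \varphi -\!* \varphi$, with the standard heaplet semantics ($x\hookrightarrow y$: $s(x)\in\mathrm{dom}(h)$ and $h(s(x))=s(y)$; $\mathrm{emp}$: empty heap; $*$: split of the heap into two disjoint heaps satisfying the two sides; $\varphi-\!*\psi$: every disjoint extension satisfying $\varphi$ gives a heap satisfying $\psi$). Valid means satisfied by all memory states. Abbreviations: $\bot:=\neg(x=x)$, $\top:=\neg\bot$, $x\neq y:=\neg(x=y)$, $\mathrm{alloc}(x):=(x\hookrightarrow x)-\!*\bot$ (holds iff $s(x)\in\mathrm{dom}(h)$), $\mathrm{size}\geq0:=\top$, $\mathrm{size}\geq1:=\neg\mathrm{emp}$, $\mathrm{size}\geq\beta+2:=\neg\mathrm{emp}*\mathrm{size}\geq\beta+1$ (holds iff $|\mathrm{dom}(h)|\geq\beta$). Core formulae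 are $x=y$, $\mathrm{alloc}(x)$, $x\hookrightarrow y$, $\mathrm{size}\geq\beta$. For finite $X$ and $\alpha\in\mathbb{N}$, $\mathrm{Core}(X,\alpha)$ is the set of core formulae $x=y,\mathrm{alloc}(x),x\hookrightarrow y,\mathrm{size}\geq\beta$ with $x,y\in X$ and $\beta\in[0,\alpha]$. For $\alpha\geq1$, $\mathrm{CoreType}(X,\alpha)$ is the set of conjunctions of literals (core formulae or their negations) over $\mathrm{Core}(X,\alpha+|X|)$ such that for each $\psi\in\mathrm{Core}(X,\alpha+|X|)$ exactly one of $\psi$, $\neg\psi$ occurs as a conjunct. The Hilbert-style system $\mathsf{C}$ consists of all instances of propositional tautologies, modus ponens, and the axiom schemata (with $\varphi$ ranging over formulae, $x,y,z$ over program variables, $\beta$ over naturals, $X'$ over finite sets of variables, and $\varphi[y\leftarrow x]$ the replacement of every occurrence of $y$ by $x$): $x=x$; $\varphi\wedge x=y\Rightarrow\varphi[y\leftarrow x]$; $x\hookrightarrow y\Rightarrow\mathrm{alloc}(x)$; $x\hookrightarrow y\wedge x\hookrightarrow z\Rightarrow y=z$; $\mathrm{size}\geq\beta+1\Rightarrow\mathrm{size}\geq\beta$; $\bigwedge_{x\in X'}(\mathrm{alloc}(x)\wedge\bigwedge_{y\in X'\setminus\{x\}}x\neq y)\Rightarrow\mathrm{size}\geq|X'|$. $\vdash_{\mathsf{C}}\varphi$ means $\varphi$ is derivable. -}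

module Defs where

open import Data.Nat using (ℕ; zero; suc; _≤_; _≟_)
open import Data.Bool using (Bool; true; false; not; _∧_)
open import Data.Maybe using (Maybe; just; nothing)
open import Data.List using (List; []; _∷_; _++_; map; filter; length)
open import Data.List.Membership.Propositional using (_∈_)
open import Data.Product using (Σ; ∃; ∃-syntax; _×_; _,_)
open import Data.Sum using (_⊎_)
open import Data.Empty using (⊥)
open import Relation.Nullary using (¬_; ¬?)
open import Relation.Binary.PropositionalEquality using (_≡_)

PVar : Set
PVar = ℕ

Loc : Set
Loc = ℕ

Store : Set
Store = PVar → Loc

record Heap : Set where
  field
    fun    : Loc → Maybe Loc
    finite : ∃[ L ] (∀ l v → fun l ≡ just v → l ∈ L)
open Heap public

Disjoint : Heap → Heap → Set
Disjoint h₁ h₂ = ∀ l → fun h₁ l ≡ nothing ⊎ fun h₂ l ≡ nothing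

unionFun : Heap → Heap → Loc → Maybe Loc
unionFun h₁ h₂ l with fun h₁ l
... | just v  = just v
... | nothing = fun h₂ l

Split : Heap → Heap → Heap → Set
Split h h₁ h₂ = Disjoint h₁ h₂ × (∀ l → fun h l ≡ unionFun h₁ h₂ l)

infix  8 _≐_ _↪_
infixr 6 _∧'_
infixr 5 _*'_
infixr 4 _-*_

data Form : Set where
  _≐_  : PVar → PVar → Form
  _↪_  : PVar → PVar → Form
  emp  : Form
  ¬'_  : Form → Form
  _∧'_ : Form → Form → Form
  _*'_ : Form → Form → Form
  _-*_ : Form → Form → Form

_,_⊨_ : Store → Heap → Form → Set
s , h ⊨ (x ≐ y)  = s x ≡ s y
s , h ⊨ (x ↪ y)  = fun h (s x) ≡ just (s y)
s , h ⊨ emp      = ∀ l → fun h l ≡ nothing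
s , h ⊨ (¬' φ)   = ¬ (s , h ⊨ φ)
s , h ⊨ (φ ∧' ψ) = (s , h ⊨ φ) × (s , h ⊨ ψ)
s , h ⊨ (φ *' ψ) = Σ Heap λ h₁ → Σ Heap λ h₂ →
                     Split h h₁ h₂ × (s , h₁ ⊨ φ) × (s , h₂ ⊨ ψ)
s , h ⊨ (φ -* ψ) = ∀ (h' h'' : Heap) → Disjoint h h' → Split h'' h h' →
                     (s , h' ⊨ φ) → (s , h'' ⊨ ψ)

Valid : Form → Set
Valid φ = ∀ (s : Store) (h : Heap) → s , h ⊨ φ

⊥' : Form
⊥' = ¬' (0 ≐ 0)

⊤' : Form
⊤' = ¬' ⊥'

infixr 3 _⇒_
_⇒_ : Form → Form → Form
φ ⇒ ψ = ¬' (φ ∧' ¬' ψ)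

_≠_ : PVar → PVar → Form
x ≠ y = ¬' (x ≐ y)

alloc : PVar → Form
alloc x = (x ↪ x) -* ⊥'

size≥ : ℕ → Form
size≥ zero          = ⊤'
size≥ (suc zero)    = ¬' emp
size≥ (suc (suc β)) = (¬' emp) *' size≥ (suc β)

⋀ : List Form → Form
⋀ []       = ⊤'
⋀ (φ ∷ φs) = φ ∧' ⋀ φs

renV : PVar → PVar → PVar → PVar
renV y x z with z ≟ y
... | Relation.Nullary.yes _ = x
... | Relation.Nullary.no  _ = z

_[_←_] : Form → PVar → PVar → Form
(a ≐ b)  [ y ← x ] = renV y x a ≐ renV y x b
(a ↪ b)  [ y ← x ] = renV y x a ↪ renV y x b
emp      [ y ← x ] = emp
(¬' φ)   [ y ← x ] = ¬' (φ [ y ← x ])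
(φ ∧' ψ) [ y ← x ] = (φ [ y ← x ]) ∧' (ψ [ y ← x ])
(φ *' ψ) [ y ← x ] = (φ [ y ← x ]) *' (ψ [ y ← x ])
(φ -* ψ) [ y ← x ] = (φ [ y ← x ]) -* (ψ [ y ← x ])

data PForm : Set where
  pvar : ℕ → PForm
  pnot : PForm → PForm
  pand : PForm → PForm → PForm

peval : (ℕ → Bool) → PForm → Bool
peval v (pvar n)   = v n
peval v (pnot p)   = not (peval v p)
peval v (pand p q) = peval v p ∧ peval v q

Tautology : PForm → Set
Tautology p = ∀ (v : ℕ → Bool) → peval v p ≡ true

instantiate : (ℕ → Form) → PForm → Form
instantiate σ (pvar n)   = σ n
instantiate σ (pnot p)   = ¬' instantiate σ p
instantiate σ (pand p q) = instantiate σ p ∧' instantiate σ q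

remove : PVar → List PVar → List PVar
remove x = filter (λ y → ¬? (y ≟ x))

allocDistinct : List PVar → Form
allocDistinct X' = ⋀ (map (λ x → alloc x ∧' ⋀ (map (λ y → x ≠ y) (remove x X'))) X')

open import Data.List.Relation.Unary.Unique.Propositional using (Unique)

data ⊢C : Form → Set where
  taut    : (p : PForm) (σ : ℕ → Form) → Tautology p → ⊢C (instantiate σ p)
  mp      : ∀ {φ ψ} → ⊢C φ → ⊢C (φ ⇒ ψ) → ⊢C ψ
  ax-refl : ∀ x → ⊢C (x ≐ x)
  ax-subst : ∀ φ x y → ⊢C ((φ ∧' (x ≐ y)) ⇒ (φ [ y ← x ]))
  ax-alloc : ∀ x y → ⊢C ((x ↪ y) ⇒ alloc x)
  ax-fun   : ∀ x y z → ⊢C (((x ↪ y) ∧' (x ↪ z)) ⇒ (y ≐ z))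
  ax-size  : ∀ β → ⊢C (size≥ (suc β) ⇒ size≥ β)
  ax-distinct : ∀ (X' : List PVar) → Unique X' →
                ⊢C (allocDistinct X' ⇒ size≥ (length X'))

data IsCore (X : List PVar) (n : ℕ) : Form → Set where
  core-eq    : ∀ {x y} → x ∈ X → y ∈ X → IsCore X n (x ≐ y)
  core-alloc : ∀ {x}   → x ∈ X → IsCore X n (alloc x)
  core-pto   : ∀ {x y} → x ∈ X → y ∈ X → IsCore X n (x ↪ y)
  core-size  : ∀ {β}   → β ≤ n → IsCore X n (size≥ β)

conjuncts : Form → List Form
conjuncts (φ ∧' ψ) = conjuncts φ ++ conjuncts ψ
conjuncts φ        = φ ∷ []

IsCoreType : List PVar → ℕ → Form → Set
IsCoreType X α φ =
  (∀ c → c ∈ conjuncts φ →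
     ∃[ ψ ] (IsCore X (α Data.Nat.+ length X) ψ × (c ≡ ψ ⊎ c ≡ ¬' ψ)))
  × (∀ ψ → IsCore X (α Data.Nat.+ length X) ψ →
       (ψ ∈ conjuncts φ × ¬ (¬' ψ ∈ conjuncts φ))
       ⊎ (¬' ψ ∈ conjuncts φ × ¬ (ψ ∈ conjuncts φ)))

module Submission where

-- Soundness holds for every formula.  The tautologies of C are only classically
-- valid and Agda's logic is constructive, so each theorem of C is shown to hold
-- up to double negation, which suffices for the negation ¬φ.
--
-- Completeness rests on the fact that the literals of a core type decide every
-- core formula.  Each closure property of the positive literals that C can
-- express (equality is an equivalence and a congruence, ↪ is functional and
-- implies alloc, the size literals are downward closed) either holds, or a
-- violating pair of literals lets C derive ¬φ.  When all of them hold, φ has a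
-- model: variables go to representatives of their equality class, the allocated
-- representatives store the representative of their target, and fresh cells pad
-- the heap to the size fixed by the size literals; the axiom on distinct
-- allocated variables guarantees that the representatives fit.

open import Defs
open import Data.Bool using (Bool; true; false; _∧_; T; if_then_else_)
open import Data.Bool.Properties using (T-∧; T-≡)
open import Data.List using (List; []; _∷_; _++_; map; filter; length; upTo)
open import Data.List.Extrema.Nat using (max; xs≤max)
open import Data.List.Membership.Propositional using (_∈_; _∉_)
open import Data.List.Membership.Propositional.Properties
  using (∈-++⁺ˡ; ∈-++⁺ʳ; ∈-++⁻; ∈-map⁺; ∈-map⁻; ∈-filter⁺; ∈-filter⁻; ∈-upTo⁺; ∈-upTo⁻)
open import Data.List.Properties
  using (filter-notAll; filter-≐; length-filter; length-map; length-++; length-upTo)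
import Data.List.Relation.Unary.All as All
import Data.List.Relation.Unary.All.Properties as Allₚ
open import Data.List.Relation.Unary.All.Properties using (¬All⇒Any¬)
open import Data.List.Relation.Unary.AllPairs using ([]; _∷_)
open import Data.List.Relation.Unary.Any as Any using (here; there)
open import Data.List.Relation.Unary.Unique.Propositional using (Unique)
import Data.List.Relation.Unary.Unique.Propositional.Properties as Uniqueₚ
open import Data.Maybe using (Maybe; just; nothing)
import Data.Maybe.Properties as Maybeₚ
open import Data.Nat using (ℕ; zero; suc; _+_; _∸_; _≤_; _<_; z≤n; s≤s; _≟_)
import Data.Nat.Properties as ℕₚ
open import Data.List.Membership.DecPropositional _≟_ using (_∈?_)
open import Data.Product as Product using (Σ; ∃; ∃-syntax; _×_; _,_; proj₁; proj₂)
open import Data.Sum as Sum using (_⊎_; inj₁; inj₂; [_,_]′)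
import Data.Sum.Effectful.Left as Sumₗ
open import Effect.Monad using (RawMonad)
open import Function using (_∘_; id; const)
open import Function.Bundles using (Equivalence; _⇔_; mk⇔)
open Equivalence using (to; from)
open import Function.Construct.Composition using (_⇔-∘_)
open import Function.Construct.Symmetry using (⇔-sym)
open import Level using (0ℓ)
open import Relation.Binary.PropositionalEquality
  using (_≡_; _≢_; refl; sym; trans; cong; cong₂; subst; subst₂; module ≡-Reasoning)
open import Relation.Nullary using (¬_; Dec; yes; no; does; proof; ¬?; _×-dec_; ¬¬-excluded-middle)
open import Relation.Nullary.Decidable using (decidable-stable)
open import Relation.Nullary.Negation using (contradiction; ¬¬-Monad)
open import Relation.Nullary.Reflects using (Reflects; ¬-reflects; _×-reflects_; invert)

p₀ p₁ p₂ : PForm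
p₀ = pvar 0
p₁ = pvar 1
p₂ = pvar 2

infixr 3 _⊃_
_⊃_ : PForm → PForm → PForm
a ⊃ b = pnot (pand a (pnot b))

σ₃ : Form → Form → Form → ℕ → Form
σ₃ P Q R 0 = P
σ₃ P Q R 1 = Q
σ₃ P Q R _ = R

val₃ : Bool → Bool → Bool → ℕ → Bool
val₃ a b c 0 = a
val₃ a b c 1 = b
val₃ a b c _ = c

everywhere : (Bool → Bool) → Bool
everywhere f = f true ∧ f false

everywhere-sound : ∀ f → T (everywhere f) → ∀ b → T (f b)
everywhere-sound f t true  = proj₁ (to T-∧ t)
everywhere-sound f t false = proj₂ (to T-∧ t)

truthTable₃ : PForm → Bool
truthTable₃ p = everywhere λ a → everywhere λ b → everywhere λ c → peval (val₃ a b c) p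

truthTable₃-sound : ∀ p → T (truthTable₃ p) → ∀ a b c → T (peval (val₃ a b c) p)
truthTable₃-sound p t a b c =
  everywhere-sound (λ c → peval (val₃ a b c) p)
    (everywhere-sound (λ b → everywhere λ c → peval (val₃ a b c) p)
      (everywhere-sound (λ a → everywhere λ b → everywhere λ c → peval (val₃ a b c) p) t a) b) c

-- A schema that depends only on the atoms 0, 1, 2 is a tautology as soon as its
-- truth table is; for a concrete schema both hypotheses hold by computation.
⊢schema : ∀ p → (∀ v → peval v p ≡ peval (val₃ (v 0) (v 1) (v 2)) p) → T (truthTable₃ p) →
          ∀ P Q R → ⊢C (instantiate (σ₃ P Q R) p)
⊢schema p onlyAtoms table P Q R = taut p (σ₃ P Q R) λ v →
  trans (onlyAtoms v) (to T-≡ (truthTable₃-sound p table (v 0) (v 1) (v 2)))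

module _ {P Q R : Form} where

  infixl 4 _⟫_
  _⟫_ : ⊢C (P ⇒ Q) → ⊢C (Q ⇒ R) → ⊢C (P ⇒ R)
  d ⟫ e = mp e (mp d (⊢schema ((p₀ ⊃ p₁) ⊃ (p₁ ⊃ p₂) ⊃ (p₀ ⊃ p₂)) (λ _ → refl) _ P Q R))

  ⇒-pair : ⊢C (P ⇒ Q) → ⊢C (P ⇒ R) → ⊢C (P ⇒ (Q ∧' R))
  ⇒-pair d e = mp e (mp d (⊢schema ((p₀ ⊃ p₁) ⊃ (p₀ ⊃ p₂) ⊃ (p₀ ⊃ pand p₁ p₂)) (λ _ → refl) _ P Q R))

  ⇒-contra : ⊢C (((¬' P) ∧' Q) ⇒ ¬' R) → ⊢C ((Q ∧' R) ⇒ P)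
  ⇒-contra d = mp d (⊢schema ((pand (pnot p₀) p₁ ⊃ pnot p₂) ⊃ (pand p₁ p₂ ⊃ p₀)) (λ _ → refl) _ P Q R)

module _ {P Q : Form} where

  ⇒-const : ⊢C Q → ⊢C (P ⇒ Q)
  ⇒-const d = mp d (⊢schema (p₁ ⊃ (p₀ ⊃ p₁)) (λ _ → refl) _ P Q Q)

  ⇒-refute : ⊢C (P ⇒ Q) → ⊢C (P ⇒ ¬' Q) → ⊢C (¬' P)
  ⇒-refute d e = mp e (mp d (⊢schema ((p₀ ⊃ p₁) ⊃ (p₀ ⊃ pnot p₁) ⊃ pnot p₀) (λ _ → refl) _ P Q Q))

  ∧-fst : ⊢C ((P ∧' Q) ⇒ P)
  ∧-fst = ⊢schema (pand p₀ p₁ ⊃ p₀) (λ _ → refl) _ P Q Q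

  ∧-snd : ⊢C ((P ∧' Q) ⇒ Q)
  ∧-snd = ⊢schema (pand p₀ p₁ ⊃ p₁) (λ _ → refl) _ P Q Q

⇒-refl : ∀ {P} → ⊢C (P ⇒ P)
⇒-refl {P} = ⊢schema (p₀ ⊃ p₀) (λ _ → refl) _ P P P

∧-swap : ∀ {P Q} → ⊢C ((P ∧' Q) ⇒ (Q ∧' P))
∧-swap = ⇒-pair ∧-snd ∧-fst

⊢⊤ : ⊢C ⊤'
⊢⊤ = ⇒-refute (⇒-const (ax-refl 0)) ⇒-refl

⊢conjunct : ∀ ψ {c} → c ∈ conjuncts ψ → ⊢C (ψ ⇒ c)
⊢conjunct (ψ₁ ∧' ψ₂) c∈ with ∈-++⁻ (conjuncts ψ₁) c∈
... | inj₁ c∈₁ = ∧-fst ⟫ ⊢conjunct ψ₁ c∈₁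
... | inj₂ c∈₂ = ∧-snd ⟫ ⊢conjunct ψ₂ c∈₂
⊢conjunct (_ ≐ _)  (here refl) = ⇒-refl
⊢conjunct (_ ↪ _)  (here refl) = ⇒-refl
⊢conjunct emp      (here refl) = ⇒-refl
⊢conjunct (¬' _)   (here refl) = ⇒-refl
⊢conjunct (_ *' _) (here refl) = ⇒-refl
⊢conjunct (_ -* _) (here refl) = ⇒-refl

⊢⋀-map : ∀ {P} (f : PVar → Form) xs → (∀ {x} → x ∈ xs → ⊢C (P ⇒ f x)) → ⊢C (P ⇒ ⋀ (map f xs))
⊢⋀-map f [] _ = ⇒-const ⊢⊤
⊢⋀-map f (x ∷ xs) d = ⇒-pair (d (here refl)) (⊢⋀-map f xs (d ∘ there))

renV-hit : ∀ y x → renV y x y ≡ x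
renV-hit y x with y ≟ y
... | yes _   = refl
... | no y≢y = contradiction refl y≢y

renV-target : ∀ y x → renV y x x ≡ x
renV-target y x with x ≟ y
... | yes _ = refl
... | no _  = refl

renV-miss : ∀ {y x z} → z ≢ y → renV y x z ≡ z
renV-miss {y} {x} {z} z≢y with z ≟ y
... | yes z≡y = contradiction z≡y z≢y
... | no _    = refl

concl-≡ : ∀ {P Q Q'} → Q ≡ Q' → ⊢C (P ⇒ Q) → ⊢C (P ⇒ Q')
concl-≡ refl d = d

hyp-≡ : ∀ {E Q Q' R} → Q ≡ Q' → ⊢C ((E ∧' Q) ⇒ R) → ⊢C ((E ∧' Q') ⇒ R)
hyp-≡ refl d = d

⊢rewrite : ∀ ψ x y → ⊢C (((x ≐ y) ∧' ψ) ⇒ (ψ [ y ← x ]))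
⊢rewrite ψ x y = ∧-swap ⟫ ax-subst ψ x y

⊢rewrite⁻ : ∀ ψ x y → ⊢C (((x ≐ y) ∧' (ψ [ y ← x ])) ⇒ ψ)
⊢rewrite⁻ ψ x y = ⇒-contra (ax-subst (¬' ψ) x y)

-- Since the
-- substitution axiom renames every occurrence of a variable, the cases where the
-- renamed variable occurs twice are handled by rewriting backwards.
⊢≐-sym : ∀ a b → ⊢C ((a ≐ b) ⇒ (b ≐ a))
⊢≐-sym a b = ⇒-pair ⇒-refl (⇒-const (ax-refl a))
           ⟫ hyp-≡ (cong₂ _≐_ (renV-hit b a) (renV-target b a)) (⊢rewrite⁻ (b ≐ a) a b)

⊢≐-trans : ∀ a b c → ⊢C (((a ≐ b) ∧' (b ≐ c)) ⇒ (a ≐ c))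
⊢≐-trans a b c with c ≟ b
... | yes refl = ∧-fst
... | no c≢b   = concl-≡ (cong₂ _≐_ (renV-hit b a) (renV-miss c≢b)) (⊢rewrite (b ≐ c) a b)

flip-eq : ∀ {a b Q} → ⊢C (((a ≐ b) ∧' Q) ⇒ ((b ≐ a) ∧' Q))
flip-eq {a} {b} = ⇒-pair (∧-fst ⟫ ⊢≐-sym a b) ∧-snd

⊢↪-congˡ : ∀ a b z → ⊢C (((a ≐ b) ∧' (b ↪ z)) ⇒ (a ↪ z))
⊢↪-congˡ a b z with z ≟ b
... | no z≢b   = concl-≡ (cong₂ _↪_ (renV-hit b a) (renV-miss z≢b)) (⊢rewrite (b ↪ z) a b)
... | yes refl = flip-eq ⟫ hyp-≡ (cong₂ _↪_ (renV-hit a b) (renV-target a b)) (⊢rewrite⁻ (a ↪ b) b a)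

⊢↪-congʳ : ∀ a b z → ⊢C (((a ≐ b) ∧' (z ↪ b)) ⇒ (z ↪ a))
⊢↪-congʳ a b z with z ≟ b
... | no z≢b   = concl-≡ (cong₂ _↪_ (renV-miss z≢b) (renV-hit b a)) (⊢rewrite (z ↪ b) a b)
... | yes refl = flip-eq ⟫ hyp-≡ (cong₂ _↪_ (renV-target a b) (renV-hit a b)) (⊢rewrite⁻ (b ↪ a) b a)

-- alloc z mentions the variable 0 (through ⊥'), so renamings of 0 need care
alloc-shape : ∀ {p q r} → p ≡ q → r ≡ 0 → ((p ↪ p) -* ¬' (r ≐ r)) ≡ alloc q
alloc-shape refl refl = refl

⊢alloc-cong : ∀ a b → ⊢C (((a ≐ b) ∧' alloc b) ⇒ alloc a)
⊢alloc-cong a b with 0 ≟ b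
... | no 0≢b   = concl-≡ (alloc-shape (renV-hit b a) (renV-miss 0≢b)) (⊢rewrite (alloc b) a b)
... | yes refl = flip-eq ⟫ hyp-≡ (alloc-shape (renV-hit a 0) (renV-target a 0)) (⊢rewrite⁻ (alloc a) 0 a)

_∈dom_ : Loc → Heap → Set
l ∈dom h = fun h l ≢ nothing

just≢nothing : ∀ {v : Loc} → just v ≢ nothing
just≢nothing ()

when : ∀ {A : Set} → Dec A → Maybe Loc → Maybe Loc
when d m = if does d then m else nothing

when-holds : ∀ {A : Set} (d : Dec A) {m v} → when d m ≡ just v → A
when-holds (yes a) _ = a

when-value : ∀ {A : Set} (d : Dec A) {m v} → when d m ≡ just v → m ≡ just v
when-value (yes _) e = e

tabulate : List Loc → (Loc → Loc) → Heap
fun (tabulate D f) l = when (l ∈? D) (just (f l))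
finite (tabulate D f) = D , λ l v → when-holds (l ∈? D)

tabulate-∈ : ∀ {D f l} → l ∈ D → fun (tabulate D f) l ≡ just (f l)
tabulate-∈ {D} {f} {l} l∈D with l ∈? D
... | yes _   = refl
... | no l∉D = contradiction l∈D l∉D

tabulate-∉ : ∀ {D f l} → l ∉ D → fun (tabulate D f) l ≡ nothing
tabulate-∉ {D} {f} {l} l∉D with l ∈? D
... | yes l∈D = contradiction l∈D l∉D
... | no _    = refl

tabulate-dom : ∀ {D f l} → l ∈dom tabulate D f ⇔ l ∈ D
tabulate-dom {D} {f} {l} = mk⇔ (λ l∈dom → decidable-stable (l ∈? D) (l∈dom ∘ tabulate-∉ {D} {f}))
                               (λ l∈D → just≢nothing ∘ trans (sym (tabulate-∈ {D} {f} l∈D)))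

tabulate-value : ∀ {D f l v} → fun (tabulate D f) l ≡ just v → f l ≡ v
tabulate-value {D} {f} {l} e = Maybeₚ.just-injective (when-value (l ∈? D) e)

restrict : Heap → {P : Loc → Set} → (∀ l → Dec (P l)) → Heap
fun (restrict h P?) l = when (P? l) (fun h l)
finite (restrict h P?) = proj₁ (finite h) , λ l v e → proj₂ (finite h) l v (when-value (P? l) e)

restrict-keeps : ∀ h {P : Loc → Set} (P? : ∀ l → Dec (P l)) {l} → P l → fun (restrict h P?) l ≡ fun h l
restrict-keeps h P? {l} Pl with P? l
... | yes _   = refl
... | no ¬Pl = contradiction Pl ¬Pl

restrict-drops : ∀ h {P : Loc → Set} (P? : ∀ l → Dec (P l)) {l} → ¬ P l → fun (restrict h P?) l ≡ nothing
restrict-drops h P? {l} ¬Pl with P? l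
... | yes Pl = contradiction Pl ¬Pl
... | no _   = refl

unionFun-left : ∀ h₁ h₂ {l} → fun h₂ l ≡ nothing → unionFun h₁ h₂ l ≡ fun h₁ l
unionFun-left h₁ h₂ {l} e with fun h₁ l
... | just _  = refl
... | nothing = e

unionFun-right : ∀ h₁ h₂ {l} → fun h₁ l ≡ nothing → unionFun h₁ h₂ l ≡ fun h₂ l
unionFun-right h₁ h₂ {l} e with fun h₁ l
... | nothing = refl

split-restrict : ∀ h {P : Loc → Set} (P? : ∀ l → Dec (P l)) →
                 Split h (restrict h P?) (restrict h (λ l → ¬? (P? l)))
split-restrict h {P} P? = disjoint , λ l → sym (covers (P? l))
  where
  h₁ h₂ : Heap
  h₁ = restrict h P?
  h₂ = restrict h (λ l → ¬? (P? l))
  disjoint : Disjoint h₁ h₂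
  disjoint l with P? l
  ... | yes _ = inj₂ refl
  ... | no _  = inj₁ refl
  covers : ∀ {l} → Dec (P l) → unionFun h₁ h₂ l ≡ fun h l
  covers (yes Pl)  = trans (unionFun-left h₁ h₂ (restrict-drops h (λ l → ¬? (P? l)) λ ¬Pl → ¬Pl Pl))
                           (restrict-keeps h P? Pl)
  covers (no ¬Pl) = trans (unionFun-right h₁ h₂ (restrict-drops h P? ¬Pl))
                           (restrict-keeps h (λ l → ¬? (P? l)) ¬Pl)

union : Heap → Heap → Heap
fun (union h₁ h₂) = unionFun h₁ h₂
finite (union h₁ h₂) = (proj₁ (finite h₁) ++ proj₁ (finite h₂)) , covered
  where
  covered : ∀ l v → unionFun h₁ h₂ l ≡ just v → l ∈ (proj₁ (finite h₁) ++ proj₁ (finite h₂))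
  covered l v e with fun h₁ l in e₁
  ... | just w  = ∈-++⁺ˡ (proj₂ (finite h₁) l w e₁)
  ... | nothing = ∈-++⁺ʳ _ (proj₂ (finite h₂) l v e)

split-undefined : ∀ {h h₁ h₂ l} → Split h h₁ h₂ → fun h l ≡ nothing → fun h₁ l ≡ nothing × fun h₂ l ≡ nothing
split-undefined {h} {h₁} {h₂} {l} (_ , covers) e with fun h₁ l | covers l
... | nothing | e' = refl , trans (sym e') e
... | just _  | e' = contradiction (trans (sym e') e) just≢nothing

split-dom : ∀ {h h₁ h₂ l} → Split h h₁ h₂ → l ∈dom h₁ ⊎ l ∈dom h₂ → l ∈dom h
split-dom {h} {h₁} {h₂} {l} sp (inj₁ l∈h₁) = l∈h₁ ∘ proj₁ ∘ split-undefined {h} {h₁} {h₂} {l} sp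
split-dom {h} {h₁} {h₂} {l} sp (inj₂ l∈h₂) = l∈h₂ ∘ proj₂ ∘ split-undefined {h} {h₁} {h₂} {l} sp

disjoint-dom : ∀ {h₁ h₂ l} → Disjoint h₁ h₂ → l ∈dom h₁ → fun h₂ l ≡ nothing
disjoint-dom {l = l} dj l∈h₁ with dj l
... | inj₁ undef = contradiction undef l∈h₁
... | inj₂ undef = undef

-- Since the domain is finite, a non-empty heap allocates some location.
undefined? : ∀ h l → Dec (fun h l ≡ nothing)
undefined? h l = Maybeₚ.≡-dec _≟_ (fun h l) nothing

nonempty⇒allocated : ∀ h → ¬ (∀ l → fun h l ≡ nothing) → ∃ (_∈dom h)
nonempty⇒allocated h nonempty with All.all? (undefined? h) (proj₁ (finite h))
... | no ¬empty = Any.satisfied (¬All⇒Any¬ (undefined? h) _ ¬empty)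
... | yes empty = contradiction outside nonempty
  where
  outside : ∀ l → fun h l ≡ nothing
  outside l with fun h l in e
  ... | nothing = refl
  ... | just v  = trans (sym e) (All.lookup empty (proj₂ (finite h) l v e))

size≥-intro : ∀ s h {ls : List Loc} → Unique ls → (∀ {l} → l ∈ ls → l ∈dom h) →
              ∀ {β} → β ≤ length ls → s , h ⊨ size≥ β
size≥-intro s h _ _ {zero} _ = λ ¬true → ¬true refl
size≥-intro s h {[]} _ _ {suc _} ()
size≥-intro s h {l ∷ _} _ allocated {suc zero} _ = λ empty → allocated (here refl) (empty l)
size≥-intro s h {l ∷ ls} (l∉ls ∷ unique) allocated {suc (suc β)} (s≤s β<) =
  restrict h (_≟ l) , restrict h (λ l' → ¬? (l' ≟ l)) , split-restrict h (_≟ l) , cell , rest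
  where
  cell : s , restrict h (_≟ l) ⊨ (¬' emp)
  cell empty = allocated (here refl) (trans (sym (restrict-keeps h (_≟ l) refl)) (empty l))
  others : ∀ {l'} → l' ∈ ls → l' ∈dom restrict h (λ l' → ¬? (l' ≟ l))
  others l'∈ls = allocated (there l'∈ls) ∘ trans (sym (restrict-keeps h (λ l' → ¬? (l' ≟ l))
                   λ l'≡l → All.lookup l∉ls l'∈ls (sym l'≡l)))
  rest : s , restrict h (λ l' → ¬? (l' ≟ l)) ⊨ size≥ (suc β)
  rest = size≥-intro s _ unique others β<

∈⇒length≥1 : ∀ {l : Loc} {D} → l ∈ D → 1 ≤ length D
∈⇒length≥1 (here _)  = s≤s z≤n
∈⇒length≥1 (there _) = s≤s z≤n

size≥-elim : ∀ s h {D : List Loc} → (∀ {l} → l ∈dom h → l ∈ D) → ∀ β → s , h ⊨ size≥ β → β ≤ length D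
size≥-elim s h covers zero _ = z≤n
size≥-elim s h covers (suc zero) nonempty = ∈⇒length≥1 (covers (proj₂ (nonempty⇒allocated h nonempty)))
size≥-elim s h {D} covers (suc (suc β)) (h₁ , h₂ , sp , nonempty , rest) =
  ℕₚ.≤-trans (s≤s (size≥-elim s h₂ covers₂ (suc β) rest)) shorter
  where
  -- some l is allocated in h₁; then h₂ lives in D without l, which is shorter than D
  l : Loc
  l = proj₁ (nonempty⇒allocated h₁ nonempty)
  l∈h₁ : l ∈dom h₁
  l∈h₁ = proj₂ (nonempty⇒allocated h₁ nonempty)
  D₂ : List Loc
  D₂ = filter (λ l' → ¬? (l' ≟ l)) D
  covers₂ : ∀ {l'} → l' ∈dom h₂ → l' ∈ D₂
  covers₂ l'∈h₂ = ∈-filter⁺ (λ l' → ¬? (l' ≟ l)) (covers (split-dom {h} {h₁} {h₂} sp (inj₂ l'∈h₂)))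
                    λ { refl → l'∈h₂ (disjoint-dom {h₁} {h₂} (proj₁ sp) l∈h₁) }
  shorter : length D₂ < length D
  shorter = filter-notAll (λ l' → ¬? (l' ≟ l)) D
              (Any.map (λ l≡x ¬x≡l → ¬x≡l (sym l≡x)) (covers (split-dom {h} {h₁} {h₂} sp (inj₁ l∈h₁))))

size≥-weaken : ∀ s h β → s , h ⊨ size≥ (suc β) → s , h ⊨ size≥ β
size≥-weaken s h zero _ = λ ¬true → ¬true refl
size≥-weaken s h (suc zero) (h₁ , h₂ , sp , nonempty , _) =
  λ empty → nonempty λ l → proj₁ (split-undefined {h} {h₁} {h₂} sp (empty l))
size≥-weaken s h (suc (suc β)) (h₁ , h₂ , sp , nonempty , rest) =
  h₁ , h₂ , sp , nonempty , size≥-weaken s h₂ (suc β) rest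

⊨alloc : ∀ s h x → s , h ⊨ alloc x ⇔ s x ∈dom h
⊨alloc s h x = mk⇔ elim intro
  where
  intro : s x ∈dom h → s , h ⊨ alloc x
  intro sx∈h h' _ dj _ pto _ with dj (s x)
  ... | inj₁ undefined  = sx∈h undefined
  ... | inj₂ undefined' = just≢nothing (trans (sym pto) undefined')
  -- otherwise the one-cell extension s x ↦ s x would satisfy ⊥'
  elim : s , h ⊨ alloc x → s x ∈dom h
  elim a undefined =
    a cell (union h cell) dj (dj , λ _ → refl) (tabulate-∈ {s x ∷ []} {λ _ → s x} (here refl)) refl
    where
    cell : Heap
    cell = tabulate (s x ∷ []) (λ _ → s x)
    dj : Disjoint h cell
    dj l with l ≟ s x
    ... | yes refl = inj₁ undefined
    ... | no l≢sx = inj₂ (tabulate-∉ {s x ∷ []} λ { (here l≡sx) → l≢sx l≡sx })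

renV-store : ∀ (s : Store) x y → s x ≡ s y → ∀ z → s (renV y x z) ≡ s z
renV-store s x y e z with z ≟ y
... | yes refl = e
... | no _     = refl

⊨rename : ∀ {s x y} → s x ≡ s y → ∀ ψ h → (s , h ⊨ (ψ [ y ← x ])) ⇔ (s , h ⊨ ψ)
⊨rename {s} {x} {y} e (a ≐ b) h = mk⇔ (subst₂ _≡_ (renV-store s x y e a) (renV-store s x y e b))
                            (subst₂ _≡_ (sym (renV-store s x y e a)) (sym (renV-store s x y e b)))
⊨rename {s} {x} {y} e (a ↪ b) h =
  mk⇔ (subst₂ stores (renV-store s x y e a) (renV-store s x y e b))
      (subst₂ stores (sym (renV-store s x y e a)) (sym (renV-store s x y e b)))
  where
  stores : Loc → Loc → Set
  stores l v = fun h l ≡ just v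
⊨rename e emp h = mk⇔ id id
⊨rename e (¬' ψ) h = mk⇔ (λ ¬a b → ¬a (from (⊨rename e ψ h) b)) (λ ¬b a → ¬b (to (⊨rename e ψ h) a))
⊨rename e (ψ ∧' χ) h = mk⇔ (Product.map (to (⊨rename e ψ h)) (to (⊨rename e χ h)))
                           (Product.map (from (⊨rename e ψ h)) (from (⊨rename e χ h)))
⊨rename e (ψ *' χ) h =
  mk⇔ (λ { (h₁ , h₂ , sp , a , b) → h₁ , h₂ , sp , to (⊨rename e ψ h₁) a , to (⊨rename e χ h₂) b })
      (λ { (h₁ , h₂ , sp , a , b) → h₁ , h₂ , sp , from (⊨rename e ψ h₁) a , from (⊨rename e χ h₂) b })
⊨rename e (ψ -* χ) h =
  mk⇔ (λ w h' h'' dj sp a → to (⊨rename e χ h'') (w h' h'' dj sp (from (⊨rename e ψ h') a)))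
      (λ w h' h'' dj sp a → from (⊨rename e χ h'') (w h' h'' dj sp (to (⊨rename e ψ h') a)))

⊨⋀-map : ∀ {s h} (f : PVar → Form) xs → s , h ⊨ ⋀ (map f xs) → ∀ {x} → x ∈ xs → s , h ⊨ f x
⊨⋀-map f (x ∷ xs) (fx , _)   (here refl) = fx
⊨⋀-map f (x ∷ xs) (_ , rest) (there x∈)  = ⊨⋀-map f xs rest x∈

⊨conjuncts : ∀ {s h} ψ → (∀ {c} → c ∈ conjuncts ψ → s , h ⊨ c) → s , h ⊨ ψ
⊨conjuncts (ψ₁ ∧' ψ₂) sat = ⊨conjuncts ψ₁ (sat ∘ ∈-++⁺ˡ) , ⊨conjuncts ψ₂ (sat ∘ ∈-++⁺ʳ (conjuncts ψ₁))
⊨conjuncts (_ ≐ _)  sat = sat (here refl)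
⊨conjuncts (_ ↪ _)  sat = sat (here refl)
⊨conjuncts emp      sat = sat (here refl)
⊨conjuncts (¬' _)   sat = sat (here refl)
⊨conjuncts (_ *' _) sat = sat (here refl)
⊨conjuncts (_ -* _) sat = sat (here refl)

map-unique : ∀ (f : ℕ → ℕ) {xs} → (∀ {x y} → x ∈ xs → y ∈ xs → x ≢ y → f x ≢ f y) →
             Unique xs → Unique (map f xs)
map-unique f injective [] = []
map-unique f injective (x∉xs ∷ unique) =
  Allₚ.map⁺ (All.tabulate λ y∈ → injective (here refl) (there y∈) (All.lookup x∉xs y∈))
  ∷ map-unique f (λ x∈ y∈ → injective (there x∈) (there y∈)) unique

⊨allocDistinct : ∀ s h X' → Unique X' → s , h ⊨ allocDistinct X' → s , h ⊨ size≥ (length X')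
⊨allocDistinct s h X' unique ad =
  subst (λ n → s , h ⊨ size≥ n) (length-map s X')
        (size≥-intro s h (map-unique s distinct unique) allocated ℕₚ.≤-refl)
  where
  clause : ∀ {x} → x ∈ X' → s , h ⊨ (alloc x ∧' ⋀ (map (x ≠_) (remove x X')))
  clause = ⊨⋀-map _ X' ad
  distinct : ∀ {x y} → x ∈ X' → y ∈ X' → x ≢ y → s x ≢ s y
  distinct {x} x∈ y∈ x≢y =
    ⊨⋀-map (x ≠_) (remove x X') (proj₂ (clause x∈)) (∈-filter⁺ (λ z → ¬? (z ≟ x)) y∈ (x≢y ∘ sym))
  allocated : ∀ {l} → l ∈ map s X' → l ∈dom h
  allocated l∈ with ∈-map⁻ s l∈
  ... | x , x∈ , refl = to (⊨alloc s h x) (proj₁ (clause x∈))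

module Soundness where
  open RawMonad (¬¬-Monad {0ℓ})

  atoms : PForm → List ℕ
  atoms (pvar n)   = n ∷ []
  atoms (pnot p)   = atoms p
  atoms (pand p q) = atoms p ++ atoms q

  _[_≔_] : (ℕ → Bool) → ℕ → Bool → ℕ → Bool
  (v [ n ≔ b ]) m with m ≟ n
  ... | yes _ = b
  ... | no _  = v m

  reflectingValuation : (S : ℕ → Set) → ∀ ns →
                        ¬ ¬ (Σ (ℕ → Bool) λ v → ∀ {n} → n ∈ ns → Reflects (S n) (v n))
  reflectingValuation S [] = return ((λ _ → false) , λ ())
  reflectingValuation S (n ∷ ns) = do
    v , reflects ← reflectingValuation S ns
    Sn? ← ¬¬-excluded-middle
    return (v [ n ≔ does Sn? ] , λ {m} → extend Sn? reflects {m})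
    where
    extend : ∀ {v} (Sn? : Dec (S n)) → (∀ {m} → m ∈ ns → Reflects (S m) (v m)) →
             ∀ {m} → m ∈ n ∷ ns → Reflects (S m) ((v [ n ≔ does Sn? ]) m)
    extend Sn? reflects {m} m∈ with m ≟ n | m∈
    ... | yes refl | _          = proof Sn?
    ... | no _     | there m∈ns = reflects m∈ns
    ... | no m≢n   | here m≡n   = contradiction m≡n m≢n

  reflects-instance : ∀ {s h} σ p {v} → (∀ {n} → n ∈ atoms p → Reflects (s , h ⊨ σ n) (v n)) →
                      Reflects (s , h ⊨ instantiate σ p) (peval v p)
  reflects-instance σ (pvar n)   r = r (here refl)
  reflects-instance σ (pnot p)   r = ¬-reflects (reflects-instance σ p r)
  reflects-instance σ (pand p q) r =
    reflects-instance σ p (r ∘ ∈-++⁺ˡ) ×-reflects reflects-instance σ q (r ∘ ∈-++⁺ʳ (atoms p))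

  ⊨tautology : ∀ {s h} σ p → Tautology p → ¬ ¬ (s , h ⊨ instantiate σ p)
  ⊨tautology {s} {h} σ p tautology = do
    v , reflects ← reflectingValuation (λ n → s , h ⊨ σ n) (atoms p)
    return (invert (subst (Reflects _) (tautology v) (reflects-instance σ p reflects)))

  -- the axiom schemata other than tautologies are implications valid outright
  ⊨⇒ : ∀ s h A B → (s , h ⊨ A → s , h ⊨ B) → s , h ⊨ (A ⇒ B)
  ⊨⇒ s h A B f (a , ¬b) = ¬b (f a)

  sound : ∀ {ψ} → ⊢C ψ → ∀ s h → ¬ ¬ (s , h ⊨ ψ)
  sound (taut p σ t) s h = ⊨tautology σ p t
  sound (mp d e) s h = do
    a ← sound d s h
    a⇒b ← sound e s h
    λ ¬b → a⇒b (a , ¬b)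
  sound (ax-refl x) s h = return refl
  sound (ax-subst ψ x y) s h = return (⊨⇒ s h (ψ ∧' (x ≐ y)) (ψ [ y ← x ])
    λ { (a , e) → from (⊨rename e ψ h) a })
  sound (ax-alloc x y) s h = return (⊨⇒ s h (x ↪ y) (alloc x)
    λ pto → from (⊨alloc s h x) λ undefined → just≢nothing (trans (sym pto) undefined))
  sound (ax-fun x y z) s h = return (⊨⇒ s h ((x ↪ y) ∧' (x ↪ z)) (y ≐ z)
    λ { (pto₁ , pto₂) → Maybeₚ.just-injective (trans (sym pto₁) pto₂) })
  sound (ax-size β) s h = return (⊨⇒ s h (size≥ (suc β)) (size≥ β) (size≥-weaken s h β))
  sound (ax-distinct X' unique) s h = return (⊨⇒ s h (allocDistinct X') (size≥ (length X'))
    (⊨allocDistinct s h X' unique))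

  soundness : ∀ {φ} → ⊢C (¬' φ) → Valid (¬' φ)
  soundness d s h sat = sound d s h (λ ¬sat → ¬sat sat)

first : ℕ → List ℕ → ℕ
first d []      = d
first d (x ∷ _) = x

first-∈ : ∀ {d x xs} → x ∈ xs → first d xs ∈ xs
first-∈ (here _)  = here refl
first-∈ (there _) = here refl

first-cases : ∀ d xs → first d xs ≡ d ⊎ first d xs ∈ xs
first-cases d []      = inj₁ refl
first-cases d (_ ∷ _) = inj₂ (here refl)

forAll : ∀ {E : Set} {P : ℕ → Set} xs → (∀ {x} → x ∈ xs → E ⊎ P x) → E ⊎ (∀ {x} → x ∈ xs → P x)
forAll [] _ = inj₂ λ ()
forAll (x ∷ xs) alt with alt (here refl) | forAll xs (alt ∘ there)
... | inj₁ e  | _        = inj₁ e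
... | inj₂ _  | inj₁ e   = inj₁ e
... | inj₂ px | inj₂ pxs = inj₂ λ { (here refl) → px ; (there x∈) → pxs x∈ }

≤-suc-cases : ∀ {β n} → β ≤ suc n → β ≤ n ⊎ β ≡ suc n
≤-suc-cases β≤ = Sum.map₁ ℕₚ.≤-pred (ℕₚ.m≤n⇒m<n∨m≡n β≤)

threshold : ∀ {P : ℕ → Set} n → (∀ {β} → β ≤ n → Dec (P β)) → P 0 → (∀ {β} → β < n → P (suc β) → P β) →
            ∃[ m ] (m ≤ n × ∀ {β} → β ≤ n → (P β ⇔ β ≤ m))
threshold zero _ P0 _ = 0 , z≤n , λ { z≤n → mk⇔ (const z≤n) (const P0) }
threshold {P} (suc n) P? P0 down
  with threshold n (λ β≤n → P? (ℕₚ.m≤n⇒m≤1+n β≤n)) P0 (λ β<n → down (ℕₚ.m≤n⇒m≤1+n β<n)) | P? (ℕₚ.≤-refl {suc n})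
... | m , m≤n , below | no ¬Psn = m , ℕₚ.m≤n⇒m≤1+n m≤n , λ β≤ → [ below , top ]′ (≤-suc-cases β≤)
  where
  top : ∀ {β} → β ≡ suc n → P β ⇔ β ≤ m
  top refl = mk⇔ (λ Psn → contradiction Psn ¬Psn)
                 (λ sn≤m → contradiction (ℕₚ.≤-trans sn≤m m≤n) (ℕₚ.<-irrefl refl))
... | m , m≤n , below | yes Psn = suc n , ℕₚ.≤-refl , λ β≤ → [ lower , top ]′ (≤-suc-cases β≤)
  where
  n≤m : n ≤ m
  n≤m = to (below ℕₚ.≤-refl) (down (ℕₚ.n<1+n n) Psn)
  lower : ∀ {β} → β ≤ n → P β ⇔ β ≤ suc n
  lower β≤n = mk⇔ (const (ℕₚ.m≤n⇒m≤1+n β≤n)) (const (from (below β≤n) (ℕₚ.≤-trans β≤n n≤m)))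
  top : ∀ {β} → β ≡ suc n → P β ⇔ β ≤ suc n
  top refl = mk⇔ (const ℕₚ.≤-refl) (const Psn)

module CoreType (X : List PVar) (X-unique : Unique X) (α : ℕ) (φ : Form) (φ-type : IsCoreType X α φ) where

  N : ℕ
  N = α + length X

  Core : Form → Set
  Core = IsCore X N

  Pos Neg : Form → Set
  Pos ψ = ψ ∈ conjuncts φ
  Neg ψ = ¬' ψ ∈ conjuncts φ

  Refuted : Set
  Refuted = ⊢C (¬' φ)

  core? : ∀ {ψ} → Core ψ → Dec (Pos ψ)
  core? c with proj₂ φ-type _ c
  ... | inj₁ (pos , _)  = yes pos
  ... | inj₂ (_ , ¬pos) = no ¬pos

  negative : ∀ {ψ} → Core ψ → ¬ Pos ψ → Neg ψ
  negative c ¬pos with proj₂ φ-type _ c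
  ... | inj₁ (pos , _) = contradiction pos ¬pos
  ... | inj₂ (neg , _) = neg

  not-both : ∀ {ψ} → Core ψ → Pos ψ → ¬ Neg ψ
  not-both c pos with proj₂ φ-type _ c
  ... | inj₁ (_ , ¬neg) = ¬neg
  ... | inj₂ (_ , ¬pos) = contradiction pos ¬pos

  ≐-vars : ∀ {a b} → Pos (a ≐ b) → a ∈ X × b ∈ X
  ≐-vars pos with proj₁ φ-type _ pos
  ... | _ , core-eq a∈ b∈ , inj₁ refl = a∈ , b∈
  ... | _ , core-alloc _ , inj₁ ()
  ... | _ , core-pto _ _ , inj₁ ()
  ... | _ , core-size {zero} _ , inj₁ ()
  ... | _ , core-size {suc zero} _ , inj₁ ()
  ... | _ , core-size {suc (suc _)} _ , inj₁ ()
  ... | _ , _ , inj₂ ()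

  ↪-vars : ∀ {a b} → Pos (a ↪ b) → a ∈ X × b ∈ X
  ↪-vars pos with proj₁ φ-type _ pos
  ... | _ , core-pto a∈ b∈ , inj₁ refl = a∈ , b∈
  ... | _ , core-eq _ _ , inj₁ ()
  ... | _ , core-alloc _ , inj₁ ()
  ... | _ , core-size {zero} _ , inj₁ ()
  ... | _ , core-size {suc zero} _ , inj₁ ()
  ... | _ , core-size {suc (suc _)} _ , inj₁ ()
  ... | _ , _ , inj₂ ()

  alloc-var : ∀ {a} → Pos (alloc a) → a ∈ X
  alloc-var pos with proj₁ φ-type _ pos
  ... | _ , core-alloc a∈ , inj₁ refl = a∈
  ... | _ , core-eq _ _ , inj₁ ()
  ... | _ , core-pto _ _ , inj₁ ()
  ... | _ , core-size {zero} _ , inj₁ ()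
  ... | _ , core-size {suc zero} _ , inj₁ ()
  ... | _ , core-size {suc (suc _)} _ , inj₁ ()
  ... | _ , _ , inj₂ ()

  pos≐? : ∀ a b → Dec (Pos (a ≐ b))
  pos≐? a b with a ∈? X | b ∈? X
  ... | yes a∈ | yes b∈ = core? (core-eq a∈ b∈)
  ... | no a∉  | _      = no (a∉ ∘ proj₁ ∘ ≐-vars)
  ... | yes _  | no b∉  = no (b∉ ∘ proj₂ ∘ ≐-vars)

  pos↪? : ∀ a b → Dec (Pos (a ↪ b))
  pos↪? a b with a ∈? X | b ∈? X
  ... | yes a∈ | yes b∈ = core? (core-pto a∈ b∈)
  ... | no a∉  | _      = no (a∉ ∘ proj₁ ∘ ↪-vars)
  ... | yes _  | no b∉  = no (b∉ ∘ proj₂ ∘ ↪-vars)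

  posAlloc? : ∀ a → Dec (Pos (alloc a))
  posAlloc? a with a ∈? X
  ... | yes a∈ = core? (core-alloc a∈)
  ... | no a∉  = no (a∉ ∘ alloc-var)

  forced : ∀ {ψ} → Core ψ → ⊢C (φ ⇒ ψ) → Refuted ⊎ Pos ψ
  forced c d with core? c
  ... | yes pos  = inj₂ pos
  ... | no ¬pos = inj₁ (⇒-refute d (⊢conjunct φ (negative c ¬pos)))

  forced₁ : ∀ {A ψ} → Core A → Core ψ → ⊢C (A ⇒ ψ) → Refuted ⊎ (Pos A → Pos ψ)
  forced₁ cA c d with core? cA
  ... | yes a  = Sum.map₂ const (forced c (⊢conjunct φ a ⟫ d))
  ... | no ¬a = inj₂ (λ a → contradiction a ¬a)

  forced₂ : ∀ {A B ψ} → Core A → Core B → Core ψ → ⊢C ((A ∧' B) ⇒ ψ) → Refuted ⊎ (Pos A → Pos B → Pos ψ)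
  forced₂ cA cB c d with core? cA | core? cB
  ... | yes a  | yes b  = Sum.map₂ (λ p _ _ → p) (forced c (⇒-pair (⊢conjunct φ a) (⊢conjunct φ b) ⟫ d))
  ... | no ¬a | _      = inj₂ (λ a _ → contradiction a ¬a)
  ... | yes _  | no ¬b = inj₂ (λ _ b → contradiction b ¬b)

  record Closed : Set where
    field
      ≐-refl     : ∀ {a} → a ∈ X → Pos (a ≐ a)
      ≐-sym      : ∀ {a} → a ∈ X → ∀ {b} → b ∈ X → Pos (a ≐ b) → Pos (b ≐ a)
      ≐-trans    : ∀ {a} → a ∈ X → ∀ {b} → b ∈ X → ∀ {c} → c ∈ X → Pos (a ≐ b) → Pos (b ≐ c) → Pos (a ≐ c)
      ↪-congˡ    : ∀ {a} → a ∈ X → ∀ {b} → b ∈ X → ∀ {z} → z ∈ X → Pos (a ≐ b) → Pos (b ↪ z) → Pos (a ↪ z)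
      ↪-congʳ    : ∀ {a} → a ∈ X → ∀ {b} → b ∈ X → ∀ {z} → z ∈ X → Pos (a ≐ b) → Pos (z ↪ b) → Pos (z ↪ a)
      alloc-cong : ∀ {a} → a ∈ X → ∀ {b} → b ∈ X → Pos (a ≐ b) → Pos (alloc b) → Pos (alloc a)
      ↪-alloc    : ∀ {x} → x ∈ X → ∀ {y} → y ∈ X → Pos (x ↪ y) → Pos (alloc x)
      ↪-fun      : ∀ {x} → x ∈ X → ∀ {y} → y ∈ X → ∀ {z} → z ∈ X → Pos (x ↪ y) → Pos (x ↪ z) → Pos (y ≐ z)
      size-zero  : Pos (size≥ 0)
      size-down  : ∀ {β} → β < N → Pos (size≥ (suc β)) → Pos (size≥ β)

  closure : Refuted ⊎ Closed
  closure = do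
    refl′ ← forAll X λ a → forced (core-eq a a) (⇒-const (ax-refl _))
    sym′ ← forAll X λ a → forAll X λ b → forced₁ (core-eq a b) (core-eq b a) (⊢≐-sym _ _)
    trans′ ← forAll X λ a → forAll X λ b → forAll X λ c →
      forced₂ (core-eq a b) (core-eq b c) (core-eq a c) (⊢≐-trans _ _ _)
    congˡ ← forAll X λ a → forAll X λ b → forAll X λ z →
      forced₂ (core-eq a b) (core-pto b z) (core-pto a z) (⊢↪-congˡ _ _ _)
    congʳ ← forAll X λ a → forAll X λ b → forAll X λ z →
      forced₂ (core-eq a b) (core-pto z b) (core-pto z a) (⊢↪-congʳ _ _ _)
    allocCong ← forAll X λ a → forAll X λ b → forced₂ (core-eq a b) (core-alloc b) (core-alloc a) (⊢alloc-cong _ _)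
    ptoAlloc ← forAll X λ x → forAll X λ y → forced₁ (core-pto x y) (core-alloc x) (ax-alloc _ _)
    ptoFun ← forAll X λ x → forAll X λ y → forAll X λ z →
      forced₂ (core-pto x y) (core-pto x z) (core-eq y z) (ax-fun _ _ _)
    size0 ← forced (core-size z≤n) (⇒-const ⊢⊤)
    down ← forAll (upTo N) λ β∈ →
      forced₁ (core-size (∈-upTo⁻ β∈)) (core-size (ℕₚ.<⇒≤ (∈-upTo⁻ β∈))) (ax-size _)
    return record
      { ≐-refl = refl′ ; ≐-sym = sym′ ; ≐-trans = trans′ ; ↪-congˡ = congˡ ; ↪-congʳ = congʳ
      ; alloc-cong = allocCong ; ↪-alloc = ptoAlloc ; ↪-fun = ptoFun
      ; size-zero = size0 ; size-down = λ β<N → down (∈-upTo⁺ β<N) }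
    where open RawMonad (Sumₗ.monad Refuted 0ℓ)

  -- The model of a closed φ: variables are sent to representatives of their
  -- equality class, the cells are the representatives with a positive alloc
  -- literal, storing the representative of their ↪-target, and fresh locations
  -- outside X pad the heap to the size prescribed by the size literals.
  module Model (closed : Closed) where
    open Closed closed

    -- the number of cells: the largest β ≤ N with size≥ β positive
    sizes : ∃[ m ] (m ≤ N × ∀ {β} → β ≤ N → (Pos (size≥ β) ⇔ β ≤ m))
    sizes = threshold N (λ β≤N → core? (core-size β≤N)) size-zero size-down

    m : ℕ
    m = proj₁ sizes

    size-literal : ∀ {β} → β ≤ N → Pos (size≥ β) ⇔ β ≤ m
    size-literal = proj₂ (proj₂ sizes)

    s : Store
    s x = first 0 (filter (λ w → pos≐? w x) X)

    s-spec : ∀ {x} → x ∈ X → s x ∈ X × Pos (s x ≐ x)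
    s-spec {x} x∈ = ∈-filter⁻ (λ w → pos≐? w x) (first-∈ (∈-filter⁺ (λ w → pos≐? w x) x∈ (≐-refl x∈)))

    s∈X : ∀ {x} → x ∈ X → s x ∈ X
    s∈X = proj₁ ∘ s-spec

    s≐ : ∀ {x} → x ∈ X → Pos (s x ≐ x)
    s≐ = proj₂ ∘ s-spec

    ≐s : ∀ {x} → x ∈ X → Pos (x ≐ s x)
    ≐s x∈ = ≐-sym (s∈X x∈) x∈ (s≐ x∈)

    -- positively equal variables have the same equality class, hence the same image
    s-cong : ∀ {x y} → x ∈ X → y ∈ X → Pos (x ≐ y) → s x ≡ s y
    s-cong {x} {y} x∈ y∈ x≐y = cong (first 0) (filter-≐ (λ w → pos≐? w x) (λ w → pos≐? w y) (toY , toX) X)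
      where
      toY : ∀ {w} → Pos (w ≐ x) → Pos (w ≐ y)
      toY w≐x = ≐-trans (proj₁ (≐-vars w≐x)) x∈ y∈ w≐x x≐y
      toX : ∀ {w} → Pos (w ≐ y) → Pos (w ≐ x)
      toX w≐y = ≐-trans (proj₁ (≐-vars w≐y)) y∈ x∈ w≐y (≐-sym x∈ y∈ x≐y)

    ⊨≐ : ∀ {x y} → x ∈ X → y ∈ X → s x ≡ s y ⇔ Pos (x ≐ y)
    ⊨≐ {x} {y} x∈ y∈ = mk⇔ equal (s-cong x∈ y∈)
      where
      equal : s x ≡ s y → Pos (x ≐ y)
      equal e = ≐-trans x∈ (s∈X x∈) y∈ (≐s x∈) (subst (λ t → Pos (t ≐ y)) (sym e) (s≐ y∈))

    cell? : ∀ c → Dec (s c ≡ c × Pos (alloc c))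
    cell? c = (s c ≟ c) ×-dec posAlloc? c

    W : List Loc
    W = filter cell? X

    W-unique : Unique W
    W-unique = Uniqueₚ.filter⁺ cell? X-unique

    W⊆X : ∀ {c} → c ∈ W → c ∈ X
    W⊆X = proj₁ ∘ ∈-filter⁻ cell? {xs = X}

    cell⇔alloc : ∀ {x} → x ∈ X → s x ∈ W ⇔ Pos (alloc x)
    cell⇔alloc {x} x∈ = mk⇔ allocated cell
      where
      allocated : s x ∈ W → Pos (alloc x)
      allocated sx∈W = alloc-cong x∈ (s∈X x∈) (≐s x∈) (proj₂ (proj₂ (∈-filter⁻ cell? {xs = X} sx∈W)))
      cell : Pos (alloc x) → s x ∈ W
      cell a = ∈-filter⁺ cell? (s∈X x∈) (s-cong (s∈X x∈) x∈ (s≐ x∈) , alloc-cong (s∈X x∈) x∈ (s≐ x∈) a)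

    fresh : Loc
    fresh = suc (max 0 X)

    X<fresh : ∀ {x} → x ∈ X → x < fresh
    X<fresh x∈ = s≤s (All.lookup (xs≤max 0 X) x∈)

    target : Loc → Loc
    target c = first fresh (map s (filter (pos↪? c) X))

    target-spec : ∀ {c y} → y ∈ X → Pos (c ↪ y) → target c ≡ s y
    target-spec {c} {y} y∈ c↪y with ∈-map⁻ s (first-∈ {fresh} (∈-map⁺ s (∈-filter⁺ (pos↪? c) y∈ c↪y)))
    ... | y' , y'∈ , e with ∈-filter⁻ (pos↪? c) y'∈
    ... | y'∈X , c↪y' = trans e (s-cong y'∈X y∈ (↪-fun (proj₁ (↪-vars c↪y)) y'∈X y∈ c↪y' c↪y))

    target-inv : ∀ {c y} → y ∈ X → target c ≡ s y → ∃[ y' ] (y' ∈ X × Pos (c ↪ y') × Pos (y ≐ y'))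
    target-inv {c} {y} y∈ e with first-cases fresh (map s (filter (pos↪? c) X))
    ... | inj₁ e-fresh = contradiction (trans (sym e) e-fresh) (ℕₚ.<⇒≢ (X<fresh (s∈X y∈)))
    ... | inj₂ ∈image with ∈-map⁻ s ∈image
    ... | y' , y'∈ , e' with ∈-filter⁻ (pos↪? c) y'∈
    ... | y'∈X , c↪y' = y' , y'∈X , c↪y' , to (⊨≐ y∈ y'∈X) (trans (sym e) e')

    ⊢allocDistinct : ⊢C (φ ⇒ allocDistinct W)
    ⊢allocDistinct = ⊢⋀-map _ W λ c∈W →
      ⇒-pair (⊢conjunct φ (proj₂ (proj₂ (∈-filter⁻ cell? {xs = X} c∈W))))
             (⊢⋀-map _ (remove _ W) λ y∈ → ⊢conjunct φ (distinct c∈W y∈))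
      where
      distinct : ∀ {c y} → c ∈ W → y ∈ remove c W → Neg (c ≐ y)
      distinct {c} {y} c∈W y∈ with ∈-filter⁻ cell? {xs = X} c∈W | ∈-filter⁻ (λ z → ¬? (z ≟ c)) y∈
      ... | c∈X , sc≡c , _ | y∈W , y≢c with ∈-filter⁻ cell? {xs = X} y∈W
      ... | y∈X , sy≡y , _ = negative (core-eq c∈X y∈X) λ c≐y →
            y≢c (trans (sym sy≡y) (trans (sym (s-cong c∈X y∈X c≐y)) sc≡c))

    W≤N : length W ≤ N
    W≤N = ℕₚ.≤-trans (length-filter cell? X) (ℕₚ.m≤n+m (length X) α)

    W-bounded : Refuted ⊎ length W ≤ m
    W-bounded = Sum.map₂ (to (size-literal W≤N))
                         (forced (core-size W≤N) (⊢allocDistinct ⟫ ax-distinct W W-unique))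

    module Satisfying (W≤m : length W ≤ m) where
      -- m ∸ |W| padding locations outside X
      R : List Loc
      R = map (fresh +_) (upTo (m ∸ length W))

      X∉R : ∀ {x} → x ∈ X → x ∉ R
      X∉R x∈ x∈R with ∈-map⁻ (fresh +_) x∈R
      ... | i , _ , refl = ℕₚ.<⇒≱ (X<fresh x∈) (ℕₚ.m≤m+n fresh i)

      U : List Loc
      U = W ++ R

      U-unique : Unique U
      U-unique = Uniqueₚ.++⁺ W-unique (Uniqueₚ.map⁺ (ℕₚ.+-cancelˡ-≡ fresh _ _) (Uniqueₚ.upTo⁺ _))
                   λ { (l∈W , l∈R) → X∉R (W⊆X l∈W) l∈R }

      |U|≡m : length U ≡ m
      |U|≡m = begin
        length (W ++ R)                ≡⟨ length-++ W ⟩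
        length W + length R            ≡⟨ cong (length W +_) |R| ⟩
        length W + (m ∸ length W)      ≡⟨ ℕₚ.m+[n∸m]≡n W≤m ⟩
        m                              ∎
        where
        open ≡-Reasoning
        |R| : length R ≡ m ∸ length W
        |R| = trans (length-map (fresh +_) (upTo (m ∸ length W))) (length-upTo (m ∸ length W))

      heap : Heap
      heap = tabulate U target

      dom-X : ∀ {x} → x ∈ X → x ∈dom heap ⇔ x ∈ W
      dom-X {x} x∈ = mk⇔ cell (from (tabulate-dom {U} {target}) ∘ ∈-++⁺ˡ)
        where
        cell : x ∈dom heap → x ∈ W
        cell x∈dom = [ id , (λ x∈R → contradiction x∈R (X∉R x∈)) ]′ (∈-++⁻ W (to (tabulate-dom {U} {target}) x∈dom))

      ⊨↪ : ∀ {x y} → x ∈ X → y ∈ X → (fun heap (s x) ≡ just (s y)) ⇔ Pos (x ↪ y)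
      ⊨↪ {x} {y} x∈ y∈ = mk⇔ stored store
        where
        stored : fun heap (s x) ≡ just (s y) → Pos (x ↪ y)
        stored e with target-inv y∈ (tabulate-value {U} {target} e)
        ... | y' , y'∈ , sx↪y' , y≐y' = ↪-congˡ x∈ (s∈X x∈) y∈ (≐s x∈) (↪-congʳ y∈ y'∈ (s∈X x∈) y≐y' sx↪y')
        store : Pos (x ↪ y) → fun heap (s x) ≡ just (s y)
        store x↪y = trans (tabulate-∈ {U} {target} (∈-++⁺ˡ (from (cell⇔alloc x∈) (↪-alloc x∈ y∈ x↪y))))
                          (cong just (target-spec y∈ (↪-congˡ (s∈X x∈) x∈ y∈ (s≐ x∈) x↪y)))

      ⊨size : ∀ β → s , heap ⊨ size≥ β ⇔ β ≤ m
      ⊨size β = mk⇔ (λ sat → subst (β ≤_) |U|≡m (size≥-elim s heap (to (tabulate-dom {U} {target})) β sat))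
                    (λ β≤m → size≥-intro s heap U-unique (from (tabulate-dom {U} {target}))
                                                     (subst (β ≤_) (sym |U|≡m) β≤m))

      ⊨core : ∀ {ψ} → Core ψ → (s , heap ⊨ ψ) ⇔ Pos ψ
      ⊨core (core-eq x∈ y∈)  = ⊨≐ x∈ y∈
      ⊨core (core-alloc x∈)  = cell⇔alloc x∈ ⇔-∘ (dom-X (s∈X x∈) ⇔-∘ ⊨alloc s heap _)
      ⊨core (core-pto x∈ y∈) = ⊨↪ x∈ y∈
      ⊨core (core-size β≤N)  = ⇔-sym (size-literal β≤N) ⇔-∘ ⊨size _

      satisfies : s , heap ⊨ φ
      satisfies = ⊨conjuncts φ literal
        where
        literal : ∀ {c} → c ∈ conjuncts φ → s , heap ⊨ c
        literal c∈ with proj₁ φ-type _ c∈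
        ... | _ , core , inj₁ refl = from (⊨core core) c∈
        ... | _ , core , inj₂ refl = λ sat → not-both core (to (⊨core core) sat) c∈

  refuted-or-satisfiable : Refuted ⊎ ∃[ s ] ∃[ h ] (s , h ⊨ φ)
  refuted-or-satisfiable = do
    closed ← closure
    W≤m ← Model.W-bounded closed
    return (Model.s closed , Model.Satisfying.heap closed W≤m , Model.Satisfying.satisfies closed W≤m)
    where open RawMonad (Sumₗ.monad Refuted 0ℓ)

-- Lemma 3.1.  For a core type φ, ¬φ is valid iff it is derivable in C: derivable
-- formulae are valid by soundness, and if ¬φ is not derivable then φ has a model,
-- so ¬φ is not valid.
lemma3p1 : (X : List PVar) → Unique X → (α : ℕ) → 1 ≤ α →
           (φ : Form) → IsCoreType X α φ →
           Valid (¬' φ) ⇔ ⊢C (¬' φ)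
lemma3p1 X X-unique α _ φ φ-type = mk⇔ completeness Soundness.soundness
  where
  completeness : Valid (¬' φ) → ⊢C (¬' φ)
  completeness valid with CoreType.refuted-or-satisfiable X X-unique α φ φ-type
  ... | inj₁ refuted            = refuted
  ... | inj₂ (s , h , satisfied) = contradiction satisfied (valid s h)
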